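{- Let $G$ be a difference graph with Young matrix $Y=(y_{ab})$, and let $(i,j)$ be an out-corner of $Y$, i.e. $y_{i,j}=1$ and $y_{i+1,j}=y_{i,j+1}=0$ (entries outside the matrix are taken to be $0$). Let $e$ be the edge of $G$ corresponding to the entry $(i,j)$. Then the number of $2$-matchings $\{e,e'\}$ of $G$ containing $e$ such that no $4$-cycle of $G$ contains both $e$ and $e'$ equals $s(Y)-ij$, where $s(Y)$ is the sum of all entries of $Y$.
   Context: All graphs are finite, simple and undirected. A $2$-matching is a set of two edges with no common vertex. A difference graph with vertex bipartition $(X_1,\ldots,X_k;Y_1,\ldots,Y_k)$ is a graph whose vertex set is the disjoint union of nonempty sets $X_1,\ldots,X_k,Y_1,\ldots,Y_k$ and in which $x\in X_i$ and $y\in Y_j$ are adjacent if and only if $i+j\le k+1$, with no other edges. Its Young matrix $Y$ has rows indexed by the vertices of $X$ listed as all vertices of $X_1$, then all of $X_2$, ..., then all of $X_k$, and columns indexed by the vertices of $Y$ listed as all of $Y_1$, then $Y_2$, ..., then $Y_k$; the entry is $1$ if the corresponding row and column vertices are adjacent and $0$ otherwise. -}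

module Defs where

open import Data.Nat using (ℕ; zero; suc; _+_; _*_; _≤_; _<_; _≤?_; _<?_)
open import Data.Fin using (Fin; toℕ; fromℕ<) renaming (_≤_ to _≤ᶠ_)
open import Data.Fin.Properties using ()
open import Data.Bool using (if_then_else_)
open import Data.List using (List; map; length; allFin)
open import Data.Nat.ListAction using (sum)
open import Data.List.Membership.Propositional using (_∈_)
open import Data.List.Relation.Unary.Unique.Propositional using (Unique)
open import Data.Product using (Σ; ∃; _×_; _,_)
open import Data.Sum using (_⊎_; inj₁; inj₂)
open import Data.Empty using (⊥)
open import Relation.Nullary using (¬_; yes; no; does)
open import Relation.Binary.PropositionalEquality using (_≡_; _≢_)
open import Function.Bundles using (_⇔_)

-- A difference graph with vertex bipartition (X_1..X_k ; Y_1..Y_k).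
-- X = Fin m, Y = Fin n, listed in the order used for the Young matrix:
-- cx x = p means x ∈ X_{p+1} (0-indexed classes); cx is monotone (all of
-- X_1 first, then X_2, ...) and surjective (each X_p nonempty). Same for Y.
record DiffGraph : Set where
  field
    k m n   : ℕ
    cx      : Fin m → Fin k
    cy      : Fin n → Fin k
    cx-mono : ∀ a b → a ≤ᶠ b → cx a ≤ᶠ cx b
    cy-mono : ∀ a b → a ≤ᶠ b → cy a ≤ᶠ cy b
    cx-surj : ∀ p → ∃ λ a → cx a ≡ p
    cy-surj : ∀ p → ∃ λ b → cy b ≡ p

module _ (D : DiffGraph) where
  open DiffGraph D

  -- x ∈ X_{p+1}, y ∈ Y_{q+1} adjacent iff (p+1)+(q+1) ≤ k+1, i.e. p+q+1 ≤ k
  AdjXY : Fin m → Fin n → Set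
  AdjXY x y = suc (toℕ (cx x) + toℕ (cy y)) ≤ k

  V : Set
  V = Fin m ⊎ Fin n

  Adj : V → V → Set
  Adj (inj₁ x) (inj₂ y) = AdjXY x y
  Adj (inj₂ y) (inj₁ x) = AdjXY x y
  Adj (inj₁ _) (inj₁ _) = ⊥
  Adj (inj₂ _) (inj₂ _) = ⊥

  entry : Fin m → Fin n → ℕ
  entry x y = if does (suc (toℕ (cx x) + toℕ (cy y)) ≤? k) then 1 else 0

  entryℕ : ℕ → ℕ → ℕ
  entryℕ a b with a <? m | b <? n
  ... | yes p | yes q = entry (fromℕ< p) (fromℕ< q)
  ... | _     | _     = 0

  sY : ℕ
  sY = sum (map (λ x → sum (map (λ y → entry x y) (allFin n))) (allFin m))

  -- (i,j) (0-indexed) is an out-corner of Y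
  OutCorner : ℕ → ℕ → Set
  OutCorner i j = entryℕ i j ≡ 1 × entryℕ (suc i) j ≡ 0 × entryℕ i (suc j) ≡ 0

  SamePair : V → V → V → V → Set
  SamePair u w a b = (u ≡ a × w ≡ b) ⊎ (u ≡ b × w ≡ a)

  record Cycle4 : Set where
    field
      v0 v1 v2 v3 : V
      d01 : v0 ≢ v1
      d02 : v0 ≢ v2
      d03 : v0 ≢ v3
      d12 : v1 ≢ v2
      d13 : v1 ≢ v3
      d23 : v2 ≢ v3
      a01 : Adj v0 v1
      a12 : Adj v1 v2
      a23 : Adj v2 v3
      a30 : Adj v3 v0

  EdgeOn : V → V → Cycle4 → Set
  EdgeOn u w C = SamePair u w v0 v1 ⊎ SamePair u w v1 v2
               ⊎ SamePair u w v2 v3 ⊎ SamePair u w v3 v0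
    where open Cycle4 C

  -- edges of G are represented by pairs (x,y) ∈ X × Y with AdjXY x y
  -- (G is bipartite with parts X, Y, so this is a bijection with E(G)).
  Good : Fin m → Fin n → Fin m × Fin n → Set
  Good i j (x , y) =
    AdjXY x y × x ≢ i × y ≢ j ×
    ¬ (Σ Cycle4 λ C → EdgeOn (inj₁ i) (inj₂ j) C × EdgeOn (inj₁ x) (inj₂ y) C)

HasCount : {A : Set} → (A → Set) → ℕ → Set
HasCount {A} P c = Σ (List A) λ l → Unique l × (∀ a → (a ∈ l) ⇔ P a) × length l ≡ c

-- In the Young matrix the entries equal to 1 form a staircase, so the rectangle of rows
-- 0..i and columns 0..j lies inside it, while below (i,j) in column j and to the right of
-- (i,j) in row i all entries are 0. Since G is bipartite, an edge {x,y} disjoint from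
-- e = {i,j} shares a 4-cycle with e only when it is the cycle i j x y, i.e. when x ~ j
-- and i ~ y, which at an out-corner means exactly that (x,y) lies in that rectangle.
-- So the good edges are the 1-entries outside the (i+1) × (j+1) rectangle.
module Submission where

open import Defs
open import Data.Nat using (ℕ; zero; suc; _+_; _*_; _≤_; _<_; _≤?_; _<?_; z≤n; s≤s; s≤s⁻¹)
open import Data.Nat.Properties
  using (≤-refl; ≤-trans; ≤-reflexive; +-mono-≤; ≰⇒>; *-zeroʳ; *-distribˡ-+; *-distribʳ-+;
         +-commutativeSemigroup)
open import Algebra.Properties.CommutativeSemigroup +-commutativeSemigroup using (interchange)
open import Data.Fin using (Fin; toℕ; fromℕ<) renaming (zero to fzero; suc to fsuc)
open import Data.Fin.Properties using (toℕ<n; fromℕ<-toℕ; toℕ-fromℕ<)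
open import Data.Bool using (if_then_else_)
open import Data.List using (List; []; _∷_; _++_; map; length; allFin; filter; cartesianProduct)
open import Data.List.Properties using (map-++; map-cong; map-tabulate)
open import Data.Nat.ListAction using (sum)
open import Data.Nat.ListAction.Properties using (sum-++)
open import Data.List.Membership.Propositional using (_∈_)
open import Data.List.Membership.Propositional.Properties
  using (∈-filter⁺; ∈-filter⁻; ∈-cartesianProduct⁺; ∈-allFin)
open import Data.List.Relation.Unary.Unique.Propositional using (Unique)
open import Data.List.Relation.Unary.Unique.Propositional.Properties
  using (filter⁺; cartesianProduct⁺; allFin⁺)
open import Data.Product using (Σ; _×_; _,_; proj₁; proj₂; uncurry)
open import Data.Sum using (inj₁; inj₂)
open import Data.Empty using (⊥-elim)
open import Relation.Nullary using (¬_; yes; no; does; Dec)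
open import Relation.Nullary.Decidable using (_×-dec_; ¬?)
open import Relation.Unary using (Pred; Decidable)
open import Relation.Binary.PropositionalEquality
  using (_≡_; refl; sym; trans; cong; cong₂; _≢_; module ≡-Reasoning)
open import Function.Bundles using (_⇔_; mk⇔; Equivalence)

open ≡-Reasoning

indicator : {P : Set} → Dec P → ℕ
indicator d = if does d then 1 else 0

module _ {P : Set} where

  indicator≡1⇒ : (p : Dec P) → indicator p ≡ 1 → P
  indicator≡1⇒ (yes p) _ = p

  indicator≡0⇒¬ : (p : Dec P) → indicator p ≡ 0 → ¬ P
  indicator≡0⇒¬ (no ¬p) _ = ¬p

module _ {P Q : Set} where

  indicator-cong : (p : Dec P) (q : Dec Q) → (P → Q) → (Q → P) → indicator p ≡ indicator q
  indicator-cong (yes _) (yes _) _   _   = refl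
  indicator-cong (yes p) (no ¬q) P⇒Q _   = ⊥-elim (¬q (P⇒Q p))
  indicator-cong (no ¬p) (yes q) _   Q⇒P = ⊥-elim (¬p (Q⇒P q))
  indicator-cong (no _)  (no _)  _   _   = refl

  indicator-×-dec : (p : Dec P) (q : Dec Q) → indicator (p ×-dec q) ≡ indicator p * indicator q
  indicator-×-dec (yes _) (yes _) = refl
  indicator-×-dec (yes _) (no _)  = refl
  indicator-×-dec (no _)  (yes _) = refl
  indicator-×-dec (no _)  (no _)  = refl

  indicator-split : (p : Dec P) (q : Dec Q) →
    indicator p ≡ indicator (p ×-dec ¬? q) + indicator (p ×-dec q)
  indicator-split (yes _) (yes _) = refl
  indicator-split (yes _) (no _)  = refl
  indicator-split (no _)  (yes _) = refl
  indicator-split (no _)  (no _)  = refl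

module _ {A : Set} where

  sum-map-cong : {f g : A → ℕ} → (∀ a → f a ≡ g a) → (xs : List A) →
    sum (map f xs) ≡ sum (map g xs)
  sum-map-cong f≗g xs = cong sum (map-cong f≗g xs)

  sum-map-+ : (f g : A → ℕ) (xs : List A) →
    sum (map (λ a → f a + g a) xs) ≡ sum (map f xs) + sum (map g xs)
  sum-map-+ f g []       = refl
  sum-map-+ f g (a ∷ xs) = begin
    f a + g a + sum (map (λ a → f a + g a) xs)      ≡⟨ cong (f a + g a +_) (sum-map-+ f g xs) ⟩
    f a + g a + (sum (map f xs) + sum (map g xs))   ≡⟨ interchange (f a) (g a) _ _ ⟩
    f a + sum (map f xs) + (g a + sum (map g xs))   ∎

  sum-map-*ˡ : (c : ℕ) (f : A → ℕ) (xs : List A) →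
    sum (map (λ a → c * f a) xs) ≡ c * sum (map f xs)
  sum-map-*ˡ c f []       = sym (*-zeroʳ c)
  sum-map-*ˡ c f (a ∷ xs) = begin
    c * f a + sum (map (λ a → c * f a) xs)  ≡⟨ cong (c * f a +_) (sum-map-*ˡ c f xs) ⟩
    c * f a + c * sum (map f xs)            ≡⟨ *-distribˡ-+ c (f a) _ ⟨
    c * (f a + sum (map f xs))              ∎

  sum-map-*ʳ : (c : ℕ) (f : A → ℕ) (xs : List A) →
    sum (map (λ a → f a * c) xs) ≡ sum (map f xs) * c
  sum-map-*ʳ c f []       = refl
  sum-map-*ʳ c f (a ∷ xs) = begin
    f a * c + sum (map (λ a → f a * c) xs)  ≡⟨ cong (f a * c +_) (sum-map-*ʳ c f xs) ⟩
    f a * c + sum (map f xs) * c            ≡⟨ *-distribʳ-+ c (f a) _ ⟨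
    (f a + sum (map f xs)) * c              ∎

  length-filter≡sum-indicator : {P : Pred A _} (P? : Decidable P) (xs : List A) →
    length (filter P? xs) ≡ sum (map (λ a → indicator (P? a)) xs)
  length-filter≡sum-indicator P? []       = refl
  length-filter≡sum-indicator P? (a ∷ xs) with P? a
  ... | yes _ = cong suc (length-filter≡sum-indicator P? xs)
  ... | no _  = length-filter≡sum-indicator P? xs

  HasCount-filter : {P Q : Pred A _} (P? : Decidable P) {xs : List A} →
    Unique xs → (∀ a → a ∈ xs) → (∀ a → P a ⇔ Q a) → HasCount Q (length (filter P? xs))
  HasCount-filter {Q = Q} P? {xs} unique complete P⇔Q =
    filter P? xs , filter⁺ P? unique , membership , refl
    where
    membership : ∀ a → (a ∈ filter P? xs) ⇔ Q a
    membership a = mk⇔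
      (λ a∈ → Equivalence.to (P⇔Q a) (proj₂ (∈-filter⁻ P? {xs = xs} a∈)))
      (λ Qa → ∈-filter⁺ P? (complete a) (Equivalence.from (P⇔Q a) Qa))

module _ {A B : Set} where

  sum-map-cartesianProduct : (f : A × B → ℕ) (xs : List A) (ys : List B) →
    sum (map f (cartesianProduct xs ys)) ≡ sum (map (λ x → sum (map (λ y → f (x , y)) ys)) xs)
  sum-map-cartesianProduct f []       ys = refl
  sum-map-cartesianProduct f (x ∷ xs) ys = begin
    sum (map f (map (x ,_) ys ++ cartesianProduct xs ys))
      ≡⟨ cong sum (map-++ f (map (x ,_) ys) _) ⟩
    sum (map f (map (x ,_) ys) ++ map f (cartesianProduct xs ys))
      ≡⟨ sum-++ (map f (map (x ,_) ys)) _ ⟩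
    sum (map f (map (x ,_) ys)) + sum (map f (cartesianProduct xs ys))
      ≡⟨ cong₂ _+_ (cong sum (map-∘ ys)) (sum-map-cartesianProduct f xs ys) ⟩
    sum (map (λ y → f (x , y)) ys) + sum (map (λ x → sum (map (λ y → f (x , y)) ys)) xs)  ∎
    where
    map-∘ : ∀ ys → map f (map (x ,_) ys) ≡ map (λ y → f (x , y)) ys
    map-∘ []       = refl
    map-∘ (y ∷ ys) = cong (f (x , y) ∷_) (map-∘ ys)

  sum-map-cartesianProduct-* : (f : A → ℕ) (g : B → ℕ) (xs : List A) (ys : List B) →
    sum (map (λ p → f (proj₁ p) * g (proj₂ p)) (cartesianProduct xs ys)) ≡
    sum (map f xs) * sum (map g ys)
  sum-map-cartesianProduct-* f g xs ys = begin
    sum (map (λ p → f (proj₁ p) * g (proj₂ p)) (cartesianProduct xs ys))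
      ≡⟨ sum-map-cartesianProduct _ xs ys ⟩
    sum (map (λ x → sum (map (λ y → f x * g y) ys)) xs)
      ≡⟨ sum-map-cong (λ x → sum-map-*ˡ (f x) g ys) xs ⟩
    sum (map (λ x → f x * sum (map g ys)) xs)
      ≡⟨ sum-map-*ʳ (sum (map g ys)) f xs ⟩
    sum (map f xs) * sum (map g ys)  ∎

sum-map-allFin-suc : ∀ m (f : Fin (suc m) → ℕ) →
  sum (map f (allFin (suc m))) ≡ f fzero + sum (map (λ x → f (fsuc x)) (allFin m))
sum-map-allFin-suc m f = cong (λ xs → f fzero + sum xs)
  (trans (map-tabulate fsuc f) (sym (map-tabulate (λ x → x) (λ x → f (fsuc x)))))

sum-indicator-toℕ< : ∀ {m} t → t ≤ m → sum (map (λ x → indicator (toℕ x <? t)) (allFin m)) ≡ t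
sum-indicator-toℕ< {zero}  zero    _         = refl
sum-indicator-toℕ< {suc m} zero    _         = begin
  sum (map (λ x → indicator (toℕ x <? 0)) (allFin (suc m)))
    ≡⟨ sum-map-allFin-suc m (λ x → indicator (toℕ x <? 0)) ⟩
  sum (map (λ x → indicator (suc (toℕ x) <? 0)) (allFin m))
    ≡⟨ sum-map-cong (λ x → indicator-cong (suc (toℕ x) <? 0) (toℕ x <? 0) (λ ()) (λ ())) (allFin m) ⟩
  sum (map (λ x → indicator (toℕ x <? 0)) (allFin m))
    ≡⟨ sum-indicator-toℕ< {m} 0 z≤n ⟩
  0  ∎
sum-indicator-toℕ< {suc m} (suc t) (s≤s t≤m) = begin
  sum (map (λ x → indicator (toℕ x <? suc t)) (allFin (suc m)))
    ≡⟨ sum-map-allFin-suc m (λ x → indicator (toℕ x <? suc t)) ⟩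
  1 + sum (map (λ x → indicator (suc (toℕ x) <? suc t)) (allFin m))
    ≡⟨ cong suc (sum-map-cong shift (allFin m)) ⟩
  1 + sum (map (λ x → indicator (toℕ x <? t)) (allFin m))
    ≡⟨ cong suc (sum-indicator-toℕ< {m} t t≤m) ⟩
  suc t  ∎
  where
  shift : ∀ x → indicator (suc (toℕ x) <? suc t) ≡ indicator (toℕ x <? t)
  shift x = indicator-cong (suc (toℕ x) <? suc t) (toℕ x <? t) s≤s⁻¹ s≤s

sum-indicator-toℕ≤ : ∀ {m} t → t < m → sum (map (λ x → indicator (toℕ x ≤? t)) (allFin m)) ≡ suc t
sum-indicator-toℕ≤ {m} t t<m = begin
  sum (map (λ x → indicator (toℕ x ≤? t)) (allFin m))
    ≡⟨ sum-map-cong (λ x → indicator-cong (toℕ x ≤? t) (toℕ x <? suc t) s≤s s≤s⁻¹) (allFin m) ⟩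
  sum (map (λ x → indicator (toℕ x <? suc t)) (allFin m))
    ≡⟨ sum-indicator-toℕ< (suc t) t<m ⟩
  suc t  ∎

module _ (D : DiffGraph) where
  open DiffGraph D
  open Cycle4

  -- Chosen so that entry D x y is definitionally indicator (adj? x y).
  adj? : ∀ x y → Dec (AdjXY D x y)
  adj? x y = suc (toℕ (cx x) + toℕ (cy y)) ≤? k

  adj-mono : ∀ {x x′ y y′} → toℕ x′ ≤ toℕ x → toℕ y′ ≤ toℕ y → AdjXY D x y → AdjXY D x′ y′
  adj-mono x′≤x y′≤y = ≤-trans (s≤s (+-mono-≤ (cx-mono _ _ x′≤x) (cy-mono _ _ y′≤y)))

  entryℕ-fromℕ< : ∀ {a b} (a<m : a < m) (b<n : b < n) →
    entryℕ D a b ≡ entry D (fromℕ< a<m) (fromℕ< b<n)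
  entryℕ-fromℕ< {a} {b} a<m b<n with a <? m | b <? n
  ... | yes _   | yes _   = refl
  ... | no a≮m  | _       = ⊥-elim (a≮m a<m)
  ... | yes _   | no b≮n  = ⊥-elim (b≮n b<n)

  entryℕ-toℕ : ∀ x y → entryℕ D (toℕ x) (toℕ y) ≡ entry D x y
  entryℕ-toℕ x y = trans (entryℕ-fromℕ< (toℕ<n x) (toℕ<n y))
    (cong₂ (entry D) (fromℕ<-toℕ x (toℕ<n x)) (fromℕ<-toℕ y (toℕ<n y)))

  entryℕ≡1⇒adj : ∀ {x y} → entryℕ D (toℕ x) (toℕ y) ≡ 1 → AdjXY D x y
  entryℕ≡1⇒adj {x} {y} e = indicator≡1⇒ (adj? x y) (trans (sym (entryℕ-toℕ x y)) e)

  entryℕ≡0⇒¬adj : ∀ {a b x y} → entryℕ D a b ≡ 0 → a ≤ toℕ x → b ≤ toℕ y → ¬ AdjXY D x y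
  entryℕ≡0⇒¬adj {a} {b} {x} {y} e a≤x b≤y adj =
    indicator≡0⇒¬ (adj? (fromℕ< a<m) (fromℕ< b<n)) (trans (sym (entryℕ-fromℕ< a<m b<n)) e)
      (adj-mono (≤-trans (≤-reflexive (toℕ-fromℕ< a<m)) a≤x)
                (≤-trans (≤-reflexive (toℕ-fromℕ< b<n)) b≤y) adj)
    where
    a<m : a < m
    a<m = ≤-trans (s≤s a≤x) (toℕ<n x)
    b<n : b < n
    b<n = ≤-trans (s≤s b≤y) (toℕ<n y)

  adj-sym : ∀ u w → Adj D u w → Adj D w u
  adj-sym (inj₁ _) (inj₂ _) a = a
  adj-sym (inj₂ _) (inj₁ _) a = a

  rotate : Cycle4 D → Cycle4 D
  rotate C = record
    { v0 = v1 C ; v1 = v2 C ; v2 = v3 C ; v3 = v0 C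
    ; d01 = d12 C ; d02 = d13 C ; d03 = λ e → d01 C (sym e)
    ; d12 = d23 C ; d13 = λ e → d02 C (sym e) ; d23 = λ e → d03 C (sym e)
    ; a01 = a12 C ; a12 = a23 C ; a23 = a30 C ; a30 = a01 C }

  reflect : Cycle4 D → Cycle4 D
  reflect C = record
    { v0 = v1 C ; v1 = v0 C ; v2 = v3 C ; v3 = v2 C
    ; d01 = λ e → d01 C (sym e) ; d02 = d13 C ; d03 = d12 C
    ; d12 = d03 C ; d13 = d02 C ; d23 = λ e → d23 C (sym e)
    ; a01 = adj-sym (v0 C) (v1 C) (a01 C) ; a12 = adj-sym (v3 C) (v0 C) (a30 C)
    ; a23 = adj-sym (v2 C) (v3 C) (a23 C) ; a30 = adj-sym (v1 C) (v2 C) (a12 C) }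

  _⊆ᴱ_ : Cycle4 D → Cycle4 D → Set
  C ⊆ᴱ C′ = ∀ {u w} → EdgeOn D u w C → EdgeOn D u w C′

  rotate-⊆ᴱ : ∀ C → C ⊆ᴱ rotate C
  rotate-⊆ᴱ C (inj₁ e)                = inj₂ (inj₂ (inj₂ e))
  rotate-⊆ᴱ C (inj₂ (inj₁ e))         = inj₁ e
  rotate-⊆ᴱ C (inj₂ (inj₂ (inj₁ e))) = inj₂ (inj₁ e)
  rotate-⊆ᴱ C (inj₂ (inj₂ (inj₂ e))) = inj₂ (inj₂ (inj₁ e))

  SamePair-swap : ∀ {u w a b} → SamePair D u w a b → SamePair D u w b a
  SamePair-swap (inj₁ e) = inj₂ e
  SamePair-swap (inj₂ e) = inj₁ e

  reflect-⊆ᴱ : ∀ C → C ⊆ᴱ reflect C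
  reflect-⊆ᴱ C (inj₁ e)                = inj₁ (SamePair-swap e)
  reflect-⊆ᴱ C (inj₂ (inj₁ e))         = inj₂ (inj₂ (inj₂ (SamePair-swap e)))
  reflect-⊆ᴱ C (inj₂ (inj₂ (inj₁ e))) = inj₂ (inj₂ (inj₁ (SamePair-swap e)))
  reflect-⊆ᴱ C (inj₂ (inj₂ (inj₂ e))) = inj₂ (inj₁ (SamePair-swap e))

  Relabelling : V D → V D → Cycle4 D → Set
  Relabelling u w C = Σ (Cycle4 D) λ C′ → v0 C′ ≡ u × v1 C′ ≡ w × C ⊆ᴱ C′

  rotate-relabelling : ∀ {u w} C → Relabelling u w (rotate C) → Relabelling u w C
  rotate-relabelling C (C′ , v0≡u , v1≡w , rotC⊆C′) =
    C′ , v0≡u , v1≡w , λ e → rotC⊆C′ (rotate-⊆ᴱ C e)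

  relabelling-from-front : ∀ {u w} C → SamePair D u w (v0 C) (v1 C) → Relabelling u w C
  relabelling-from-front C (inj₁ (u≡v0 , w≡v1)) = C , sym u≡v0 , sym w≡v1 , λ e → e
  relabelling-from-front C (inj₂ (u≡v1 , w≡v0)) = reflect C , sym u≡v1 , sym w≡v0 , reflect-⊆ᴱ C

  edge⇒relabelling : ∀ {u w} C → EdgeOn D u w C → Relabelling u w C
  edge⇒relabelling C (inj₁ e) = relabelling-from-front C e
  edge⇒relabelling C (inj₂ (inj₁ e)) =
    rotate-relabelling C (relabelling-from-front (rotate C) e)
  edge⇒relabelling C (inj₂ (inj₂ (inj₁ e))) =
    rotate-relabelling C (rotate-relabelling (rotate C)
      (relabelling-from-front (rotate (rotate C)) e))
  edge⇒relabelling C (inj₂ (inj₂ (inj₂ e))) =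
    rotate-relabelling C (rotate-relabelling (rotate C) (rotate-relabelling (rotate (rotate C))
      (relabelling-from-front (rotate (rotate (rotate C))) e)))

  cross-adj-from-front : ∀ {i x j y} (C : Cycle4 D) → v0 C ≡ inj₁ i → v1 C ≡ inj₂ j →
    EdgeOn D (inj₁ x) (inj₂ y) C → x ≢ i → y ≢ j → AdjXY D x j × AdjXY D i y
  cross-adj-from-front record { a12 = a12 ; a30 = a30 } refl refl e x≢i y≢j with e
  ... | inj₁ (inj₁ (refl , _))                = ⊥-elim (x≢i refl)
  ... | inj₁ (inj₂ (() , _))
  ... | inj₂ (inj₁ (inj₁ (() , _)))
  ... | inj₂ (inj₁ (inj₂ (_ , refl)))         = ⊥-elim (y≢j refl)
  ... | inj₂ (inj₂ (inj₁ (inj₁ (refl , refl)))) = a12 , a30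
  ... | inj₂ (inj₂ (inj₁ (inj₂ (refl , refl)))) = ⊥-elim a12
  ... | inj₂ (inj₂ (inj₂ (inj₁ (_ , ()))))
  ... | inj₂ (inj₂ (inj₂ (inj₂ (refl , _))))  = ⊥-elim (x≢i refl)

  cross-adj : ∀ {i x j y} (C : Cycle4 D) →
    EdgeOn D (inj₁ i) (inj₂ j) C → EdgeOn D (inj₁ x) (inj₂ y) C →
    x ≢ i → y ≢ j → AdjXY D x j × AdjXY D i y
  cross-adj C ij∈C xy∈C with edge⇒relabelling C ij∈C
  ... | C′ , v0≡i , v1≡j , C⊆C′ = cross-adj-from-front C′ v0≡i v1≡j (C⊆C′ xy∈C)

  square : ∀ {i x j y} → AdjXY D i j → AdjXY D x j → AdjXY D x y → AdjXY D i y →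
    x ≢ i → y ≢ j → Cycle4 D
  square {i} {x} {j} {y} i~j x~j x~y i~y x≢i y≢j = record
    { v0 = inj₁ i ; v1 = inj₂ j ; v2 = inj₁ x ; v3 = inj₂ y
    ; d01 = λ () ; d02 = λ { refl → x≢i refl } ; d03 = λ ()
    ; d12 = λ () ; d13 = λ { refl → y≢j refl } ; d23 = λ ()
    ; a01 = i~j ; a12 = x~j ; a23 = x~y ; a30 = i~y }

module OutCornerCount (D : DiffGraph) (i : Fin (DiffGraph.m D)) (j : Fin (DiffGraph.n D))
                      (corner : OutCorner D (toℕ i) (toℕ j)) where
  open DiffGraph D

  corner-adj : AdjXY D i j
  corner-adj = entryℕ≡1⇒adj D (proj₁ corner)

  column-bound : ∀ {x} → AdjXY D x j → toℕ x ≤ toℕ i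
  column-bound {x} x~j with toℕ x ≤? toℕ i
  ... | yes x≤i = x≤i
  ... | no  x≰i = ⊥-elim (entryℕ≡0⇒¬adj D (proj₁ (proj₂ corner)) (≰⇒> x≰i) ≤-refl x~j)

  row-bound : ∀ {y} → AdjXY D i y → toℕ y ≤ toℕ j
  row-bound {y} i~y with toℕ y ≤? toℕ j
  ... | yes y≤j = y≤j
  ... | no  y≰j = ⊥-elim (entryℕ≡0⇒¬adj D (proj₂ (proj₂ corner)) ≤-refl (≰⇒> y≰j) i~y)

  InRectangle : Fin m × Fin n → Set
  InRectangle (x , y) = toℕ x ≤ toℕ i × toℕ y ≤ toℕ j

  inRectangle? : Decidable InRectangle
  inRectangle? (x , y) = (toℕ x ≤? toℕ i) ×-dec (toℕ y ≤? toℕ j)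

  AdjOutside : Fin m × Fin n → Set
  AdjOutside p = uncurry (AdjXY D) p × ¬ InRectangle p

  adjOutside? : Decidable AdjOutside
  adjOutside? (x , y) = adj? D x y ×-dec ¬? (inRectangle? (x , y))

  rectangle⇒adj : ∀ {x y} → InRectangle (x , y) → AdjXY D x y
  rectangle⇒adj (x≤i , y≤j) = adj-mono D x≤i y≤j corner-adj

  adjOutside⇔good : ∀ p → AdjOutside p ⇔ Good D i j p
  adjOutside⇔good (x , y) = mk⇔ to from
    where
    to : AdjOutside (x , y) → Good D i j (x , y)
    to (x~y , outside) = x~y , x≢i , y≢j , no-common-cycle
      where
      x≢i : x ≢ i
      x≢i refl = outside (≤-refl , row-bound x~y)
      y≢j : y ≢ j
      y≢j refl = outside (column-bound x~y , ≤-refl)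
      no-common-cycle :
        ¬ (Σ (Cycle4 D) λ C → EdgeOn D (inj₁ i) (inj₂ j) C × EdgeOn D (inj₁ x) (inj₂ y) C)
      no-common-cycle (C , ij∈C , xy∈C) with cross-adj D C ij∈C xy∈C x≢i y≢j
      ... | x~j , i~y = outside (column-bound x~j , row-bound i~y)

    from : Good D i j (x , y) → AdjOutside (x , y)
    from (x~y , x≢i , y≢j , no-common-cycle) = x~y , λ { (x≤i , y≤j) →
      no-common-cycle
        ( square D corner-adj (rectangle⇒adj (x≤i , ≤-refl)) x~y (rectangle⇒adj (≤-refl , y≤j))
                 x≢i y≢j
        , inj₁ (inj₁ (refl , refl)) , inj₂ (inj₂ (inj₁ (inj₁ (refl , refl))))) }

  χ-outside χ-rectangle : Fin m × Fin n → ℕ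
  χ-outside p   = indicator (adjOutside? p)
  χ-rectangle p = indicator (inRectangle? p)

  entry-split : ∀ x y → entry D x y ≡ χ-outside (x , y) + χ-rectangle (x , y)
  entry-split x y = trans (indicator-split (adj? D x y) (inRectangle? (x , y)))
    (cong (χ-outside (x , y) +_)
      (indicator-cong (adj? D x y ×-dec inRectangle? (x , y)) (inRectangle? (x , y))
        proj₂ (λ r → rectangle⇒adj r , r)))

  pairs : List (Fin m × Fin n)
  pairs = cartesianProduct (allFin m) (allFin n)

  rectangle-size : sum (map χ-rectangle pairs) ≡ suc (toℕ i) * suc (toℕ j)
  rectangle-size = begin
    sum (map χ-rectangle pairs)
      ≡⟨ sum-map-cong (λ (x , y) → indicator-×-dec (toℕ x ≤? toℕ i) (toℕ y ≤? toℕ j)) pairs ⟩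
    sum (map (λ (x , y) → χ-rows x * χ-columns y) pairs)
      ≡⟨ sum-map-cartesianProduct-* χ-rows χ-columns (allFin m) (allFin n) ⟩
    sum (map χ-rows (allFin m)) * sum (map χ-columns (allFin n))
      ≡⟨ cong₂ _*_ (sum-indicator-toℕ≤ (toℕ i) (toℕ<n i)) (sum-indicator-toℕ≤ (toℕ j) (toℕ<n j)) ⟩
    suc (toℕ i) * suc (toℕ j)  ∎
    where
    χ-rows : Fin m → ℕ
    χ-rows x = indicator (toℕ x ≤? toℕ i)
    χ-columns : Fin n → ℕ
    χ-columns y = indicator (toℕ y ≤? toℕ j)

  adjOutside-count : length (filter adjOutside? pairs) + suc (toℕ i) * suc (toℕ j) ≡ sY D
  adjOutside-count = begin
    length (filter adjOutside? pairs) + suc (toℕ i) * suc (toℕ j)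
      ≡⟨ cong₂ _+_ (length-filter≡sum-indicator adjOutside? pairs) (sym rectangle-size) ⟩
    sum (map χ-outside pairs) + sum (map χ-rectangle pairs)
      ≡⟨ sum-map-+ χ-outside χ-rectangle pairs ⟨
    sum (map (λ p → χ-outside p + χ-rectangle p) pairs)
      ≡⟨ sum-map-cong (λ (x , y) → entry-split x y) pairs ⟨
    sum (map (uncurry (entry D)) pairs)
      ≡⟨ sum-map-cartesianProduct (uncurry (entry D)) (allFin m) (allFin n) ⟩
    sY D  ∎

lemma4p9 : (D : DiffGraph) → (i : Fin (DiffGraph.m D)) → (j : Fin (DiffGraph.n D)) →
    OutCorner D (toℕ i) (toℕ j) →
    Σ ℕ λ c → HasCount (Good D i j) c × c + suc (toℕ i) * suc (toℕ j) ≡ sY D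
lemma4p9 D i j corner =
  length (filter adjOutside? pairs) ,
  HasCount-filter adjOutside? (cartesianProduct⁺ (allFin⁺ m) (allFin⁺ n))
    (λ (x , y) → ∈-cartesianProduct⁺ (∈-allFin x) (∈-allFin y)) adjOutside⇔good ,
  adjOutside-count
  where
  open DiffGraph D
  open OutCornerCount D i j corner
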